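{- Let $q$ be a prime power, let $d \ge 2$ be an integer, and let $f:\mathbb{F}_q^d \to \mathbb{F}_q$ be a linear bipermutive local rule $f(x_1,\ldots,x_d) = a_1x_1 + \cdots + a_dx_d$ (so $a_1 \neq 0$ and $a_d \neq 0$). Let $F:\mathbb{F}_q^{2(d-1)} \to \mathbb{F}_q^{d-1}$ be the no-boundary cellular automaton with local rule $f$. Let $M_F$ be the $(d-1)\times 2(d-1)$ matrix over $\mathbb{F}_q$ whose entry in row $i$ and column $k$ ($1\le i\le d-1$, $1 \le k \le 2(d-1)$) is $a_{k-i+1}$ if $1 \le k-i+1 \le d$ and $0$ otherwise (so that $F(z) = M_F z^\top$). Let $M_s$ be the $2(d-1)\times 2(d-1)$ permutation matrix which swaps the two halves of a vector, i.e. $M_s (x\|y)^\top = (y\|x)^\top$ for all $x,y\in\mathbb{F}_q^{d-1}$, and let $M_{F^\top} = M_F M_s$. Let $M_{F,F^\top}$ be the $2(d-1)\times 2(d-1)$ matrix obtained by stacking $M_F$ on top of $M_{F^\top}$. Then $F$ is self-orthogonal if and only if $M_{F,F^\top}$ is invertible.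
   Context: For a finite field $\mathbb{F}_q$ and a local rule $f:\mathbb{F}_q^d\to\mathbb{F}_q$, the no-boundary cellular automaton (NBCA) $F:\mathbb{F}_q^{2(d-1)}\to\mathbb{F}_q^{d-1}$ is defined by $F(x_1,\ldots,x_{2(d-1)}) = (f(x_1,\ldots,x_d), f(x_2,\ldots,x_{d+1}),\ldots, f(x_{d-1},\ldots,x_{2(d-1)}))$. The rule $f$ is bipermutive if for every fixed value of $(x_2,\ldots,x_d)$ the map $x_1\mapsto f(x_1,\ldots,x_d)$ is a permutation of $\mathbb{F}_q$, and for every fixed value of $(x_1,\ldots,x_{d-1})$ the map $x_d\mapsto f(x_1,\ldots,x_d)$ is a permutation of $\mathbb{F}_q$. Let $N = q^{d-1}$, $[N]=\{1,\ldots,N\}$, fix a bijection $\phi:\mathbb{F}_q^{d-1}\to[N]$ with inverse $\psi$. The Cayley table of $F$ is the $N\times N$ matrix $C_F$ with $C_F(i,j) = \phi(F(\psi(i)\|\psi(j)))$, where $\|$ denotes concatenation; when $f$ is bipermutive, $C_F$ is a Latin square (each element of $[N]$ occurs exactly once in each row and each column). Two Latin squares $L_1,L_2$ of order $N$ are orthogonal if the pairs $(L_1(i,j),L_2(i,j))$, $(i,j)\in[N]\times[N]$, are pairwise distinct. The NBCA $F$ (with bipermutive $f$) is called self-orthogonal if $C_F$ is orthogonal to its transpose $C_F^\top$. -}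

module Defs where

open import Data.Nat as ℕ using (ℕ; zero; suc; _≤_; _<_; _≤?_; _<?_; _∸_; _^_)
open import Data.Nat.Properties using (+-mono-<-≤; m∸n≤m)
open import Data.Fin as Fin using (Fin; toℕ; fromℕ<; splitAt; _↑ˡ_; _↑ʳ_)
open import Data.Fin.Properties using (toℕ<n; toℕ≤pred[n])
open import Data.Vec using (Vec; _∷_; []; _∷ʳ_; _++_; lookup; tabulate)
open import Data.Sum using (inj₁; inj₂)
open import Data.Product using (∃; _×_)
open import Relation.Nullary using (¬_; yes; no)
open import Relation.Binary.PropositionalEquality using (_≡_)
open import Function.Bundles using (_↔_; Inverse)
open import Function.Definitions using (Bijective)
import Algebra.Structures as AS

-- A finite field is a
-- commutative ring (w.r.t. propositional equality) with 0 ≠ 1 in which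
-- every nonzero element has a multiplicative inverse, together with an
-- enumeration of its q = size elements.  (q is then automatically a
-- prime power, and every prime power arises.)

record FiniteField : Set₁ where
  infixl 6 _+_
  infixl 7 _*_
  field
    Carrier : Set
    _+_ _*_ : Carrier → Carrier → Carrier
    -_      : Carrier → Carrier
    0# 1#   : Carrier
    isCommutativeRing : AS.IsCommutativeRing _≡_ _+_ _*_ -_ 0# 1#
    0≢1     : ¬ (0# ≡ 1#)
    inverse : ∀ x → ¬ (x ≡ 0#) → ∃ λ y → x * y ≡ 1#
    size    : ℕ
    enum    : Fin size ↔ Carrier

module _ (K : FiniteField) where
  open FiniteField K

  Σ : ∀ {m} → (Fin m → Carrier) → Carrier
  Σ {zero}  g = 0#
  Σ {suc m} g = g Fin.zero + Σ (λ i → g (Fin.suc i))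

  -- Local rules with d = suc n inputs, and the NBCA F : K^(2n) → K^n.

  LocalRule : ℕ → Set
  LocalRule n = Vec Carrier (suc n) → Carrier

  Bipermutive : ∀ {n} → LocalRule n → Set
  Bipermutive {n} f =
    (∀ (rest : Vec Carrier n) → Bijective _≡_ _≡_ (λ x → f (x ∷ rest))) ×
    (∀ (rest : Vec Carrier n) → Bijective _≡_ _≡_ (λ x → f (rest ∷ʳ x)))

  window-idx : ∀ {n} → Fin n → Fin (suc n) → Fin (n ℕ.+ n)
  window-idx {n} i j = fromℕ< (+-mono-<-≤ (toℕ<n i) (toℕ≤pred[n] j))

  NBCA : ∀ {n} → LocalRule n → Vec Carrier (n ℕ.+ n) → Vec Carrier n
  NBCA {n} f z = tabulate (λ i → f (tabulate (λ j → lookup z (window-idx i j))))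

  -- linear local rule  f(x) = a₁x₁ + … + a_d x_d  (0-based indices here)
  linearRule : ∀ {n} → (Fin (suc n) → Carrier) → LocalRule n
  linearRule a x = Σ (λ j → a j * lookup x j)

  CayleyTable : ∀ {n} → LocalRule n → (Vec Carrier n ↔ Fin (size ^ n)) →
                Fin (size ^ n) → Fin (size ^ n) → Fin (size ^ n)
  CayleyTable f φ i j = Inverse.to φ (NBCA f (Inverse.from φ i ++ Inverse.from φ j))

  Orthogonal : ∀ {N} → (Fin N → Fin N → Fin N) → (Fin N → Fin N → Fin N) → Set
  Orthogonal L₁ L₂ = ∀ i j i′ j′ → L₁ i j ≡ L₁ i′ j′ → L₂ i j ≡ L₂ i′ j′ →
                     (i ≡ i′ × j ≡ j′)

  transpose : ∀ {N} → (Fin N → Fin N → Fin N) → Fin N → Fin N → Fin N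
  transpose L i j = L j i

  SelfOrthogonal : ∀ {n} → LocalRule n → (Vec Carrier n ↔ Fin (size ^ n)) → Set
  SelfOrthogonal f φ = Orthogonal (CayleyTable f φ) (transpose (CayleyTable f φ))

  Matrix : ℕ → ℕ → Set
  Matrix r c = Fin r → Fin c → Carrier

  _·_ : ∀ {r m c} → Matrix r m → Matrix m c → Matrix r c
  (A · B) i j = Σ (λ k → A i k * B k j)

  identity : ∀ {m} → Matrix m m
  identity i j with i Fin.≟ j
  ... | yes _ = 1#
  ... | no  _ = 0#

  Invertible : ∀ {m} → Matrix m m → Set
  Invertible {m} A = ∃ λ (B : Matrix m m) →
    (∀ i j → (A · B) i j ≡ identity i j) × (∀ i j → (B · A) i j ≡ identity i j)

  -- M_F : n × 2n, entry (i,k) = a_{k-i} if 0 ≤ k-i ≤ n, else 0 (0-based)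
  M-F : ∀ {n} → (Fin (suc n) → Carrier) → Matrix n (n ℕ.+ n)
  M-F {n} a i k with toℕ i ≤? toℕ k
  ... | no _ = 0#
  ... | yes _ with toℕ k ∸ toℕ i <? suc n
  ...   | yes p = a (fromℕ< p)
  ...   | no _  = 0#

  swapIdx : ∀ {n} → Fin (n ℕ.+ n) → Fin (n ℕ.+ n)
  swapIdx {n} r with splitAt n r
  ... | inj₁ i = n ↑ʳ i
  ... | inj₂ j = j ↑ˡ n

  -- M_s: (M_s v)_r = v_{swapIdx r}, i.e. M_s (x‖y)ᵀ = (y‖x)ᵀ
  M-s : ∀ {n} → Matrix (n ℕ.+ n) (n ℕ.+ n)
  M-s {n} r c with swapIdx {n} r Fin.≟ c
  ... | yes _ = 1#
  ... | no  _ = 0#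

  M-Fᵀ : ∀ {n} → (Fin (suc n) → Carrier) → Matrix n (n ℕ.+ n)
  M-Fᵀ {n} a = M-F a · M-s {n}

  M-FFᵀ : ∀ {n} → (Fin (suc n) → Carrier) → Matrix (n ℕ.+ n) (n ℕ.+ n)
  M-FFᵀ {n} a r c with splitAt n r
  ... | inj₁ i = M-F a i c
  ... | inj₂ i = M-Fᵀ a i c

{-# OPTIONS --safe #-}

-- In the coordinates z = x ‖ y of K^{2(d-1)} we have M_{F,Fᵀ} z = (F(x ‖ y), F(y ‖ x)): each row
-- of M_F evaluates the linear rule on one window, and M_s swaps the two halves.  Through the
-- bijection φ this map is (i, j) ↦ (C_F(i, j), C_Fᵀ(i, j)), so self-orthogonality says exactly
-- that z ↦ M_{F,Fᵀ} z is injective.  On the finite set K^{2(d-1)} an injective map is onto, and a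
-- square matrix acting bijectively is invertible: the preimages of the unit vectors form a right
-- inverse B, and B is also a left inverse because A (B A) = A and z ↦ A z is injective.

module Submission where

open import Defs
open import Algebra.Bundles using (CommutativeRing)
import Algebra.Properties.Semiring.Sum as SemiringSum
open import Data.Fin as Fin using (Fin; toℕ; fromℕ<; splitAt; punchIn; punchOut)
open import Data.Fin.Properties
  using (any?; punchOut-injective; punchInᵢ≢i; injective⇒≤; toℕ<n; fromℕ<-toℕ; toℕ≤pred[n]; *↔×)
open import Data.Nat as ℕ using (ℕ; zero; suc; _≤_; _<_; _^_; _≤?_; _<?_; _∸_)
import Data.Nat.Properties as ℕₚ
open import Data.Product using (∃; _×_; _,_; proj₁; proj₂)
open import Data.Product.Function.NonDependent.Propositional using (_×-↔_)
open import Data.Sum using (inj₁; inj₂)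
open import Data.Vec as Vec using (Vec; lookup; tabulate; _++_)
open import Data.Vec.Properties
  using ( lookup∘tabulate; tabulate∘lookup; tabulate-cong; ++-injective
        ; lookup-++ˡ; lookup-++ʳ; lookup-splitAt)
open import Function using (_∘_; _↔_; _⇔_; mk⇔; Inverse; Injection)
open import Function.Definitions using (Injective)
open import Function.Properties.Inverse using (↔-sym; ↔-trans; ↔⇒↣)
open import Relation.Nullary using (yes; no; contradiction)
open import Relation.Binary.PropositionalEquality
open ≡-Reasoning

Fin-injective⇒surjective : ∀ {k} (g : Fin k → Fin k) → Injective _≡_ _≡_ g →
                           ∀ y → ∃ λ x → g x ≡ y
Fin-injective⇒surjective {zero}  g g-injective ()
Fin-injective⇒surjective {suc k} g g-injective y with any? (λ x → g x Fin.≟ y)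
... | yes hit = hit
... | no ¬hit = contradiction (injective⇒≤ squeezed-injective) ℕₚ.1+n≰n
  where
  missed : ∀ x → y ≢ g x
  missed x y≡gx = ¬hit (x , sym y≡gx)
  squeezed-injective : Injective _≡_ _≡_ (λ x → punchOut (missed x))
  squeezed-injective e = g-injective (punchOut-injective (missed _) (missed _) e)

module _ {a b} {A : Set a} {B : Set b} (e : A ↔ B) where
  open Inverse e

  ↔-to-injective : Injective _≡_ _≡_ to
  ↔-to-injective = Injection.injective (↔⇒↣ e)

  ↔-from-injective : Injective _≡_ _≡_ from
  ↔-from-injective = Injection.injective (↔⇒↣ (↔-sym e))

↔Fin-injective⇒surjective : ∀ {a} {A : Set a} {k} → A ↔ Fin k → (g : A → A) →
                            Injective _≡_ _≡_ g → ∀ y → ∃ λ x → g x ≡ y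
↔Fin-injective⇒surjective e g g-injective y = from (proj₁ preimage) , ↔-to-injective e (proj₂ preimage)
  where
  open Inverse e
  preimage : ∃ λ i → to (g (from i)) ≡ to y
  preimage = Fin-injective⇒surjective (to ∘ g ∘ from)
    (↔-from-injective e ∘ g-injective ∘ ↔-to-injective e) (to y)

×-↔Fin : ∀ {a b} {A : Set a} {B : Set b} {k l} → A ↔ Fin k → B ↔ Fin l → (A × B) ↔ Fin (k ℕ.* l)
×-↔Fin e e′ = ↔-trans (e ×-↔ e′) (↔-sym *↔×)

module _ (K : FiniteField) where
  open FiniteField K

  commutativeRing : CommutativeRing _ _
  commutativeRing = record
    { Carrier = Carrier ; _≈_ = _≡_ ; _+_ = _+_ ; _*_ = _*_ ; -_ = -_ ; 0# = 0# ; 1# = 1#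
    ; isCommutativeRing = isCommutativeRing }

  open CommutativeRing commutativeRing
    using (+-identityˡ; +-identityʳ; +-assoc; *-assoc; *-identityˡ; *-identityʳ; zeroˡ; zeroʳ)
  open SemiringSum (CommutativeRing.semiring commutativeRing)
    using (sum; sum-cong-≗; ∑-comm; sum-remove; sum-replicate-zero; *-distribˡ-sum; *-distribʳ-sum)

  Σ≡sum : ∀ {m} (g : Fin m → Carrier) → Σ K g ≡ sum g
  Σ≡sum {zero}  g = refl
  Σ≡sum {suc m} g = cong (g Fin.zero +_) (Σ≡sum (g ∘ Fin.suc))

  sum-select : ∀ {m} (i : Fin m) (g : Fin m → Carrier) → (∀ j → j ≢ i → g j ≡ 0#) → sum g ≡ g i
  sum-select {suc m} i g off = begin
    sum g                             ≡⟨ sum-remove {i = i} g ⟩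
    g i + sum (λ j → g (punchIn i j)) ≡⟨ cong (g i +_) rest≡0 ⟩
    g i + 0#                          ≡⟨ +-identityʳ (g i) ⟩
    g i                               ∎
    where
    rest≡0 : sum (λ j → g (punchIn i j)) ≡ 0#
    rest≡0 = trans (sum-cong-≗ (λ j → off (punchIn i j) (punchInᵢ≢i i j))) (sum-replicate-zero m)

  -- Sums over ℕ-ranges let a window be cut out of a sum without casts between Fin types.
  sumTo : ℕ → (ℕ → Carrier) → Carrier
  sumTo m h = sum {m} (h ∘ toℕ)

  sumTo-+ : ∀ p q h → sumTo (p ℕ.+ q) h ≡ sumTo p h + sumTo q (λ j → h (p ℕ.+ j))
  sumTo-+ zero    q h = sym (+-identityˡ _)
  sumTo-+ (suc p) q h = trans (cong (h 0 +_) (sumTo-+ p q (h ∘ suc))) (sym (+-assoc _ _ _))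

  sumTo-zero : ∀ m h → (∀ k → k < m → h k ≡ 0#) → sumTo m h ≡ 0#
  sumTo-zero m h vanish =
    trans (sum-cong-≗ (λ k → vanish (toℕ k) (toℕ<n k))) (sum-replicate-zero m)

  sumTo-window : ∀ {m} t d h → t ℕ.+ d ≤ m →
                 (∀ k → k < t → h k ≡ 0#) → (∀ j → d ≤ j → h (t ℕ.+ j) ≡ 0#) →
                 sumTo m h ≡ sumTo d (λ j → h (t ℕ.+ j))
  sumTo-window t d h t+d≤m below above with ℕₚ.m≤n⇒∃[o]m+o≡n t+d≤m
  ... | e , refl = begin
    sumTo (t ℕ.+ d ℕ.+ e) h                     ≡⟨ cong (λ l → sumTo l h) (ℕₚ.+-assoc t d e) ⟩
    sumTo (t ℕ.+ (d ℕ.+ e)) h                   ≡⟨ sumTo-+ t (d ℕ.+ e) h ⟩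
    sumTo t h + sumTo (d ℕ.+ e) hₜ              ≡⟨ cong₂ _+_ (sumTo-zero t h below) (sumTo-+ d e hₜ) ⟩
    0# + (sumTo d hₜ + sumTo e (hₜ ∘ (d ℕ.+_))) ≡⟨ cong (λ s → 0# + (sumTo d hₜ + s)) tail≡0 ⟩
    0# + (sumTo d hₜ + 0#)                      ≡⟨ trans (+-identityˡ _) (+-identityʳ _) ⟩
    sumTo d hₜ                                  ∎
    where
    hₜ : ℕ → Carrier
    hₜ j = h (t ℕ.+ j)
    tail≡0 : sumTo e (hₜ ∘ (d ℕ.+_)) ≡ 0#
    tail≡0 = sumTo-zero e _ (λ j _ → above (d ℕ.+ j) (ℕₚ.m≤m+n d j))

  infixr 8 _·ᵥ_

  _·ᵥ_ : ∀ {r c} → Matrix K r c → (Fin c → Carrier) → Fin r → Carrier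
  (A ·ᵥ v) i = sum (λ k → A i k * v k)

  column : ∀ {r c} → Matrix K r c → Fin c → Fin r → Carrier
  column A j i = A i j

  ·-column : ∀ {r m c} (A : Matrix K r m) (B : Matrix K m c) i j →
             _·_ K A B i j ≡ (A ·ᵥ column B j) i
  ·-column A B i j = Σ≡sum (λ k → A i k * B k j)

  ·ᵥ-cong : ∀ {r c} (A : Matrix K r c) {v w} → v ≗ w → A ·ᵥ v ≗ A ·ᵥ w
  ·ᵥ-cong A v≗w i = sum-cong-≗ (λ k → cong (A i k *_) (v≗w k))

  ·-·ᵥ : ∀ {r m c} (A : Matrix K r m) (B : Matrix K m c) v → _·_ K A B ·ᵥ v ≗ A ·ᵥ B ·ᵥ v
  ·-·ᵥ A B v i = begin
    sum (λ k → _·_ K A B i k * v k)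
      ≡⟨ sum-cong-≗ (λ k → cong (_* v k) (·-column A B i k)) ⟩
    sum (λ k → sum (λ l → A i l * B l k) * v k)
      ≡⟨ sum-cong-≗ (λ k → *-distribʳ-sum (v k) (λ l → A i l * B l k)) ⟩
    sum (λ k → sum (λ l → A i l * B l k * v k))
      ≡⟨ ∑-comm (λ k l → A i l * B l k * v k) ⟩
    sum (λ l → sum (λ k → A i l * B l k * v k))
      ≡⟨ sum-cong-≗ (λ l → sum-cong-≗ (λ k → *-assoc (A i l) (B l k) (v k))) ⟩
    sum (λ l → sum (λ k → A i l * (B l k * v k)))
      ≡⟨ sum-cong-≗ (λ l → *-distribˡ-sum (A i l) (λ k → B l k * v k)) ⟨
    sum (λ l → A i l * sum (λ k → B l k * v k))
      ∎

  ·ᵥ-selector : ∀ {r c} (A : Matrix K r c) (π : Fin r → Fin c) →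
                (∀ i → A i (π i) ≡ 1#) → (∀ i k → k ≢ π i → A i k ≡ 0#) → ∀ v → A ·ᵥ v ≗ v ∘ π
  ·ᵥ-selector A π one off v i = begin
    sum (λ k → A i k * v k) ≡⟨ sum-select (π i) (λ k → A i k * v k) off-terms ⟩
    A i (π i) * v (π i)     ≡⟨ cong (_* v (π i)) (one i) ⟩
    1# * v (π i)            ≡⟨ *-identityˡ (v (π i)) ⟩
    v (π i)                 ∎
    where
    off-terms : ∀ k → k ≢ π i → A i k * v k ≡ 0#
    off-terms k k≢πi = trans (cong (_* v k) (off i k k≢πi)) (zeroˡ (v k))

  identity-diag : ∀ {m} (i : Fin m) → identity K i i ≡ 1#
  identity-diag i with i Fin.≟ i
  ... | yes _   = refl
  ... | no i≢i = contradiction refl i≢i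

  identity-off : ∀ {m} (i j : Fin m) → j ≢ i → identity K i j ≡ 0#
  identity-off i j j≢i with i Fin.≟ j
  ... | yes i≡j = contradiction (sym i≡j) j≢i
  ... | no _    = refl

  identity-·ᵥ : ∀ {m} v → identity K {m} ·ᵥ v ≗ v
  identity-·ᵥ = ·ᵥ-selector (identity K) (λ i → i) identity-diag identity-off

  ·ᵥ-identity-column : ∀ {r c} (A : Matrix K r c) j → A ·ᵥ column (identity K) j ≗ column A j
  ·ᵥ-identity-column A j i = begin
    sum (λ k → A i k * identity K k j) ≡⟨ sum-select j (λ k → A i k * identity K k j) off-terms ⟩
    A i j * identity K j j             ≡⟨ cong (A i j *_) (identity-diag j) ⟩
    A i j * 1#                         ≡⟨ *-identityʳ (A i j) ⟩
    A i j                              ∎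
    where
    off-terms : ∀ k → k ≢ j → A i k * identity K k j ≡ 0#
    off-terms k k≢j = trans (cong (A i k *_) (identity-off k j (k≢j ∘ sym))) (zeroʳ (A i k))

  invertible⇒·ᵥ-injective : ∀ {m} {A : Matrix K m m} → Invertible K A →
                            ∀ {v w} → A ·ᵥ v ≗ A ·ᵥ w → v ≗ w
  invertible⇒·ᵥ-injective {A = A} (B , _ , BA≡I) {v} {w} Av≗Aw i = begin
    v i             ≡⟨ B·A·u≗u v i ⟨
    (B ·ᵥ A ·ᵥ v) i ≡⟨ ·ᵥ-cong B Av≗Aw i ⟩
    (B ·ᵥ A ·ᵥ w) i ≡⟨ B·A·u≗u w i ⟩
    w i             ∎
    where
    B·A·u≗u : ∀ u → B ·ᵥ A ·ᵥ u ≗ u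
    B·A·u≗u u i = begin
      (B ·ᵥ A ·ᵥ u) i       ≡⟨ ·-·ᵥ B A u i ⟨
      (_·_ K B A ·ᵥ u) i    ≡⟨ sum-cong-≗ (λ k → cong (_* u k) (BA≡I i k)) ⟩
      (identity K ·ᵥ u) i   ≡⟨ identity-·ᵥ u i ⟩
      u i                   ∎

  ·ᵥ-bijective⇒invertible : ∀ {m} (A : Matrix K m m) →
                            (∀ {v w} → A ·ᵥ v ≗ A ·ᵥ w → v ≗ w) → (∀ w → ∃ λ v → A ·ᵥ v ≗ w) →
                            Invertible K A
  ·ᵥ-bijective⇒invertible {m} A injective surjective = B , AB≡I , BA≡I
    where
    B : Matrix K m m
    B i j = proj₁ (surjective (column (identity K) j)) i

    AB≡I : ∀ i j → _·_ K A B i j ≡ identity K i j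
    AB≡I i j = trans (·-column A B i j) (proj₂ (surjective (column (identity K) j)) i)

    A·B·Aⱼ≗A·Iⱼ : ∀ j → A ·ᵥ B ·ᵥ column A j ≗ A ·ᵥ column (identity K) j
    A·B·Aⱼ≗A·Iⱼ j r = begin
      (A ·ᵥ B ·ᵥ column A j) r          ≡⟨ ·-·ᵥ A B _ r ⟨
      (_·_ K A B ·ᵥ column A j) r       ≡⟨ sum-cong-≗ (λ k → cong (_* A k j) (AB≡I r k)) ⟩
      (identity K ·ᵥ column A j) r      ≡⟨ identity-·ᵥ (column A j) r ⟩
      A r j                             ≡⟨ ·ᵥ-identity-column A j r ⟨
      (A ·ᵥ column (identity K) j) r    ∎

    BA≡I : ∀ i j → _·_ K B A i j ≡ identity K i j
    BA≡I i j = trans (·-column B A i j) (injective (A·B·Aⱼ≗A·Iⱼ j) i)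

  join : ∀ {m₁ m₂} → Vec Carrier m₁ × Vec Carrier m₂ → Fin (m₁ ℕ.+ m₂) → Carrier
  join (x , y) = lookup (x ++ y)

  lookup-injective : ∀ {m} {x y : Vec Carrier m} → lookup x ≗ lookup y → x ≡ y
  lookup-injective {x = x} {y} x≗y = begin
    x                   ≡⟨ tabulate∘lookup x ⟨
    tabulate (lookup x) ≡⟨ tabulate-cong x≗y ⟩
    tabulate (lookup y) ≡⟨ tabulate∘lookup y ⟩
    y                   ∎

  join-injective : ∀ {m₁ m₂} {p q : Vec Carrier m₁ × Vec Carrier m₂} → join p ≗ join q → p ≡ q
  join-injective {p = x , y} {x′ , y′} p≗q with ++-injective x x′ (lookup-injective p≗q)
  ... | refl , refl = refl

  join-surjective : ∀ {m₁ m₂} (v : Fin (m₁ ℕ.+ m₂) → Carrier) → ∃ λ p → v ≗ join p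
  join-surjective {m₁} v with Vec.splitAt m₁ (tabulate v)
  ... | x , y , v≡x++y =
    (x , y) , λ i → trans (sym (lookup∘tabulate v i)) (cong (λ z → lookup z i) v≡x++y)

  Represents : ∀ {m₁ m₂ r₁ r₂} → Matrix K (r₁ ℕ.+ r₂) (m₁ ℕ.+ m₂) →
               (Vec Carrier m₁ × Vec Carrier m₂ → Vec Carrier r₁ × Vec Carrier r₂) → Set
  Represents A T = ∀ p → A ·ᵥ join p ≗ join (T p)

  module _ {m₁ m₂ r₁ r₂} {A : Matrix K (r₁ ℕ.+ r₂) (m₁ ℕ.+ m₂)}
           {T : Vec Carrier m₁ × Vec Carrier m₂ → Vec Carrier r₁ × Vec Carrier r₂}
           (A-represents-T : Represents A T) where

    represented-injective⇒·ᵥ-injective : Injective _≡_ _≡_ T →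
                                         ∀ {v w} → A ·ᵥ v ≗ A ·ᵥ w → v ≗ w
    represented-injective⇒·ᵥ-injective T-injective {v} {w} Av≗Aw
      with join-surjective v | join-surjective w
    ... | p , v≗p | q , w≗q = λ i → trans (v≗p i) (trans (cong (λ s → join s i) p≡q) (sym (w≗q i)))
      where
      Tp≗Tq : join (T p) ≗ join (T q)
      Tp≗Tq k = begin
        join (T p) k    ≡⟨ A-represents-T p k ⟨
        (A ·ᵥ join p) k ≡⟨ ·ᵥ-cong A v≗p k ⟨
        (A ·ᵥ v) k      ≡⟨ Av≗Aw k ⟩
        (A ·ᵥ w) k      ≡⟨ ·ᵥ-cong A w≗q k ⟩
        (A ·ᵥ join q) k ≡⟨ A-represents-T q k ⟩
        join (T q) k    ∎
      p≡q : p ≡ q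
      p≡q = T-injective (join-injective Tp≗Tq)

    ·ᵥ-injective⇒represented-injective : (∀ {v w} → A ·ᵥ v ≗ A ·ᵥ w → v ≗ w) →
                                         Injective _≡_ _≡_ T
    ·ᵥ-injective⇒represented-injective A-injective {p} {q} Tp≡Tq = join-injective (A-injective Ap≗Aq)
      where
      Ap≗Aq : A ·ᵥ join p ≗ A ·ᵥ join q
      Ap≗Aq k =
        trans (A-represents-T p k) (trans (cong (λ s → join s k) Tp≡Tq) (sym (A-represents-T q k)))

    represented-surjective⇒·ᵥ-surjective : (∀ q → ∃ λ p → T p ≡ q) → ∀ w → ∃ λ v → A ·ᵥ v ≗ w
    represented-surjective⇒·ᵥ-surjective T-surjective w with join-surjective w
    ... | q , w≗q with T-surjective q
    ...   | p , Tp≡q =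
      join p , λ k → trans (A-represents-T p k) (trans (cong (λ s → join s k) Tp≡q) (sym (w≗q k)))

  extend : ∀ {m} → (Fin m → Carrier) → ℕ → Carrier
  extend {m} v k with k <? m
  ... | yes k<m = v (fromℕ< k<m)
  ... | no  _   = 0#

  extend-< : ∀ {m} (v : Fin m → Carrier) {k} (k<m : k < m) → extend v k ≡ v (fromℕ< k<m)
  extend-< {m} v {k} k<m with k <? m
  ... | yes _   = refl
  ... | no k≮m = contradiction k<m k≮m

  extend-toℕ : ∀ {m} (v : Fin m → Carrier) i → extend v (toℕ i) ≡ v i
  extend-toℕ v i = trans (extend-< v (toℕ<n i)) (cong v (fromℕ<-toℕ i (toℕ<n i)))

  extend-≥ : ∀ {m} (v : Fin m → Carrier) {k} → m ≤ k → extend v k ≡ 0#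
  extend-≥ {m} v {k} m≤k with k <? m
  ... | yes k<m = contradiction m≤k (ℕₚ.<⇒≱ k<m)
  ... | no _    = refl

  lookup-++-swapIdx : ∀ {n} (x y : Vec Carrier n) r →
                      lookup (x ++ y) (swapIdx K {n} r) ≡ lookup (y ++ x) r
  lookup-++-swapIdx {n} x y r rewrite lookup-splitAt n y x r with splitAt n r
  ... | inj₁ i = lookup-++ʳ x y i
  ... | inj₂ i = lookup-++ˡ x y i

  M-s-diag : ∀ {n} (r : Fin (n ℕ.+ n)) → M-s K {n} r (swapIdx K {n} r) ≡ 1#
  M-s-diag {n} r = M-s-at (swapIdx K {n} r) refl
    where
    M-s-at : ∀ c → swapIdx K {n} r ≡ c → M-s K {n} r c ≡ 1#
    M-s-at c ≡c with swapIdx K {n} r Fin.≟ c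
    ... | yes _  = refl
    ... | no  ≢c = contradiction ≡c ≢c

  M-s-off : ∀ {n} (r c : Fin (n ℕ.+ n)) → c ≢ swapIdx K {n} r → M-s K {n} r c ≡ 0#
  M-s-off {n} r c c≢ with swapIdx K {n} r Fin.≟ c
  ... | yes ≡c = contradiction (sym ≡c) c≢
  ... | no  _  = refl

  M-s-·ᵥ : ∀ {n} (x y : Vec Carrier n) → M-s K {n} ·ᵥ lookup (x ++ y) ≗ lookup (y ++ x)
  M-s-·ᵥ {n} x y r = trans
    (·ᵥ-selector (M-s K {n}) (swapIdx K {n}) (M-s-diag {n}) (M-s-off {n}) (lookup (x ++ y)) r)
    (lookup-++-swapIdx x y r)

  pairedNBCA : ∀ {n} → LocalRule K n → Vec Carrier n × Vec Carrier n → Vec Carrier n × Vec Carrier n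
  pairedNBCA f (x , y) = NBCA K f (x ++ y) , NBCA K f (y ++ x)

  module _ {n} (a : Fin (suc n) → Carrier) where

    band : ℕ → ℕ → Carrier
    band t k with t ≤? k
    ... | yes _ = extend a (k ∸ t)
    ... | no  _ = 0#

    M-F≡band : ∀ i k → M-F K a i k ≡ band (toℕ i) (toℕ k)
    M-F≡band i k with toℕ i ≤? toℕ k
    ... | no  _ = refl
    ... | yes _ with toℕ k ∸ toℕ i <? suc n
    ...   | yes _ = refl
    ...   | no  _ = refl

    band-< : ∀ {t k} → k < t → band t k ≡ 0#
    band-< {t} {k} k<t with t ≤? k
    ... | yes t≤k = contradiction t≤k (ℕₚ.<⇒≱ k<t)
    ... | no  _   = refl

    band-shift : ∀ t j → band t (t ℕ.+ j) ≡ extend a j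
    band-shift t j with t ≤? t ℕ.+ j
    ... | yes _   = cong (extend a) (ℕₚ.m+n∸m≡n t j)
    ... | no t≰t+j = contradiction (ℕₚ.m≤m+n t j) t≰t+j

    lookup-NBCA-linearRule : ∀ z i →
      lookup (NBCA K (linearRule K a) z) i ≡ sum (λ j → a j * lookup z (window-idx K i j))
    lookup-NBCA-linearRule z i = begin
      lookup (NBCA K (linearRule K a) z) i
        ≡⟨ lookup∘tabulate (λ i → linearRule K a (window i)) i ⟩
      linearRule K a (window i)
        ≡⟨ Σ≡sum (λ j → a j * lookup (window i) j) ⟩
      sum (λ j → a j * lookup (window i) j)
        ≡⟨ sum-cong-≗ (λ j → cong (a j *_) (lookup∘tabulate (lookup z ∘ window-idx K i) j)) ⟩
      sum (λ j → a j * lookup z (window-idx K i j))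
        ∎
      where
      window : Fin n → Vec Carrier (suc n)
      window i = tabulate (λ j → lookup z (window-idx K i j))

    M-F-·ᵥ : ∀ z → M-F K a ·ᵥ lookup z ≗ lookup (NBCA K (linearRule K a) z)
    M-F-·ᵥ z i = begin
      sum (λ k → M-F K a i k * lookup z k)
        ≡⟨ sum-cong-≗ (λ k → cong₂ _*_ (M-F≡band i k) (sym (extend-toℕ (lookup z) k))) ⟩
      sumTo (n ℕ.+ n) h
        ≡⟨ sumTo-window t (suc n) h window-fits below above ⟩
      sumTo (suc n) (λ j → h (t ℕ.+ j))
        ≡⟨ sum-cong-≗ (λ j → cong₂ _*_ (coefficient j) (extend-< (lookup z) (in-range j))) ⟩
      sum (λ j → a j * lookup z (window-idx K i j))
        ≡⟨ lookup-NBCA-linearRule z i ⟨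
      lookup (NBCA K (linearRule K a) z) i
        ∎
      where
      t : ℕ
      t = toℕ i
      h : ℕ → Carrier
      h k = band t k * extend (lookup z) k
      window-fits : t ℕ.+ suc n ≤ n ℕ.+ n
      window-fits = subst (_≤ n ℕ.+ n) (sym (ℕₚ.+-suc t n)) (ℕₚ.+-monoˡ-≤ n (toℕ<n i))
      below : ∀ k → k < t → h k ≡ 0#
      below k k<t = trans (cong (_* _) (band-< k<t)) (zeroˡ _)
      above : ∀ j → suc n ≤ j → h (t ℕ.+ j) ≡ 0#
      above j n<j = trans (cong (_* _) (trans (band-shift t j) (extend-≥ a n<j))) (zeroˡ _)
      coefficient : ∀ j → band t (t ℕ.+ toℕ j) ≡ a j
      coefficient j = trans (band-shift t (toℕ j)) (extend-toℕ a j)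
      in-range : ∀ j → t ℕ.+ toℕ j < n ℕ.+ n
      in-range j = ℕₚ.+-mono-<-≤ (toℕ<n i) (toℕ≤pred[n] j)

    M-Fᵀ-·ᵥ : ∀ (x y : Vec Carrier n) →
              M-Fᵀ K a ·ᵥ lookup (x ++ y) ≗ lookup (NBCA K (linearRule K a) (y ++ x))
    M-Fᵀ-·ᵥ x y r = begin
      (M-Fᵀ K a ·ᵥ lookup (x ++ y)) r             ≡⟨ ·-·ᵥ (M-F K a) (M-s K {n}) (lookup (x ++ y)) r ⟩
      (M-F K a ·ᵥ M-s K {n} ·ᵥ lookup (x ++ y)) r ≡⟨ ·ᵥ-cong (M-F K a) (M-s-·ᵥ x y) r ⟩
      (M-F K a ·ᵥ lookup (y ++ x)) r              ≡⟨ M-F-·ᵥ (y ++ x) r ⟩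
      lookup (NBCA K (linearRule K a) (y ++ x)) r ∎

    M-FFᵀ-represents : Represents (M-FFᵀ K a) (pairedNBCA (linearRule K a))
    M-FFᵀ-represents (x , y) r
      rewrite lookup-splitAt n (NBCA K (linearRule K a) (x ++ y)) (NBCA K (linearRule K a) (y ++ x)) r
      with splitAt n r
    ... | inj₁ i = M-F-·ᵥ (x ++ y) i
    ... | inj₂ i = M-Fᵀ-·ᵥ x y i

  module _ {n} (f : LocalRule K n) (φ : Vec Carrier n ↔ Fin (size ^ n)) where
    open Inverse φ

    CayleyTable-to : ∀ x y → CayleyTable K f φ (to x) (to y) ≡ to (NBCA K f (x ++ y))
    CayleyTable-to x y =
      cong₂ (λ u w → to (NBCA K f (u ++ w))) (strictlyInverseʳ x) (strictlyInverseʳ y)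

    selfOrthogonal⇒pairedNBCA-injective : SelfOrthogonal K f φ → Injective _≡_ _≡_ (pairedNBCA f)
    selfOrthogonal⇒pairedNBCA-injective orthogonal {x , y} {x′ , y′} eq =
      cong₂ _,_ (↔-to-injective φ (proj₁ to-equal)) (↔-to-injective φ (proj₂ to-equal))
      where
      to-equal : to x ≡ to x′ × to y ≡ to y′
      to-equal = orthogonal (to x) (to y) (to x′) (to y′)
        (trans (CayleyTable-to x y) (trans (cong (to ∘ proj₁) eq) (sym (CayleyTable-to x′ y′))))
        (trans (CayleyTable-to y x) (trans (cong (to ∘ proj₂) eq) (sym (CayleyTable-to y′ x′))))

    pairedNBCA-injective⇒selfOrthogonal : Injective _≡_ _≡_ (pairedNBCA f) → SelfOrthogonal K f φ
    pairedNBCA-injective⇒selfOrthogonal injective i j i′ j′ Cᵢⱼ≡Cᵢ′ⱼ′ Cⱼᵢ≡Cⱼ′ᵢ′ =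
      ↔-from-injective φ (cong proj₁ from-equal) , ↔-from-injective φ (cong proj₂ from-equal)
      where
      from-equal : (from i , from j) ≡ (from i′ , from j′)
      from-equal = injective (cong₂ _,_ (↔-to-injective φ Cᵢⱼ≡Cᵢ′ⱼ′) (↔-to-injective φ Cⱼᵢ≡Cⱼ′ᵢ′))

lemma2 : (K : FiniteField) (n : ℕ) → 1 ≤ n →
         (a : Fin (suc n) → FiniteField.Carrier K) →
         Bipermutive K (linearRule K a) →
         (φ : Vec (FiniteField.Carrier K) n ↔ Fin (FiniteField.size K ^ n)) →
         SelfOrthogonal K (linearRule K a) φ ⇔ Invertible K (M-FFᵀ K a)
lemma2 K n _ a _ φ = mk⇔ selfOrthogonal⇒invertible invertible⇒selfOrthogonal
  where
  f : LocalRule K n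
  f = linearRule K a

  M : Matrix K (n ℕ.+ n) (n ℕ.+ n)
  M = M-FFᵀ K a

  M-represents : Represents K M (pairedNBCA K f)
  M-represents = M-FFᵀ-represents K a

  selfOrthogonal⇒invertible : SelfOrthogonal K f φ → Invertible K M
  selfOrthogonal⇒invertible orthogonal = ·ᵥ-bijective⇒invertible K M
    (represented-injective⇒·ᵥ-injective K M-represents injective)
    (represented-surjective⇒·ᵥ-surjective K M-represents
      (↔Fin-injective⇒surjective (×-↔Fin φ φ) (pairedNBCA K f) injective))
    where
    injective : Injective _≡_ _≡_ (pairedNBCA K f)
    injective = selfOrthogonal⇒pairedNBCA-injective K f φ orthogonal

  invertible⇒selfOrthogonal : Invertible K M → SelfOrthogonal K f φ
  invertible⇒selfOrthogonal invertible = pairedNBCA-injective⇒selfOrthogonal K f φ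
    (·ᵥ-injective⇒represented-injective K M-represents (invertible⇒·ᵥ-injective K invertible))
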